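{- Let $f\colon\mathbb Z\to\mathbb Z$ be LIP on $\mathbb Z$ and suppose that for all but finitely many $x\in\mathbb Z$ (with $x\neq 0$) $$|f(x)|<\frac{(2|x|-1)!}{2^{2|x|-1}}.$$ Then there is $p\in\mathbb Z[x]$ with $f(x)=p(x)$ for all $x\in\mathbb Z$.
   Context: A function $f\colon\mathbb Z\to\mathbb Z$ is LIP on $\mathbb Z$ if for every finite $X\subseteq\mathbb Z$ there is $p\in\mathbb Z[x]$ with $p(x)=f(x)$ for all $x\in X$. -}

module Defs where

open import Data.Integer using (ℤ; +_; _+_; _*_; ∣_∣)
open import Data.Nat as ℕ using (ℕ; _∸_; _^_; _<_)
open import Data.Nat using (_!)
open import Data.List using (List; []; _∷_)
open import Data.List.Membership.Propositional using (_∈_)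
open import Data.Product using (∃)
open import Relation.Binary.PropositionalEquality using (_≡_)
open import Relation.Nullary using (¬_)

-- Polynomials in ℤ[x] as coefficient lists, lowest degree first:
-- a₀ ∷ a₁ ∷ … represents a₀ + a₁ x + …
Poly : Set
Poly = List ℤ

eval : Poly → ℤ → ℤ
eval []       x = + 0
eval (a ∷ as) x = a + x * eval as x

LIP : (ℤ → ℤ) → Set
LIP f = (X : List ℤ) → ∃ λ (p : Poly) → ∀ x → x ∈ X → f x ≡ eval p x

-- The growth bound |f(x)| < (2|x|-1)! / 2^(2|x|-1), written with the
-- (positive) denominator cleared, in ℕ.
GrowthBound : (ℤ → ℤ) → ℤ → Set
GrowthBound f x =
  ∣ f x ∣ ℕ.* 2 ^ (2 ℕ.* ∣ x ∣ ∸ 1) < (2 ℕ.* ∣ x ∣ ∸ 1) !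

-- Δⁿ of an integer polynomial is divisible by n!, and Δⁿ f a depends only on f(a), …, f(a + n),
-- so every Δⁿ f a of a LIP function f is divisible by n!.  Also |Δⁿ f a| ≤ 2ⁿ max |f(a + i)|;
-- when the window a, …, a + n lies in [-m, m] with 2m ≤ n + 1, the growth bound makes this
-- smaller than n! once n is large, so such central differences vanish.  Reducing a polynomial
-- that agrees with f on [-N, N] modulo ∏ (x - w) gives q of degree ≤ 2N that still agrees with
-- f there; g = f - q vanishes on [-N, N] and its central differences of order > 2N vanish.
-- The difference of order 2k + 1 over [-k, k + 1] then forces g(k + 1) = 0, and the one of
-- order 2k + 2 over [-k - 1, k + 1] forces g(-k - 1) = 0, so g = 0 everywhere.
module Submission where

open import Defs
import Data.Integer.Properties as ℤP
open import Data.Integer.Divisibility.Signed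
  using (_∣_; ∣m∣n⇒∣m+n; ∣n⇒∣m*n; *-monoʳ-∣; ∣⇒∣ᵤ; ∣ᵤ⇒∣)
open import Data.Nat as ℕ using (ℕ; zero; suc; z≤n; s≤s; z<s; _≤_; _<_; _^_; _∸_; _!)
open import Data.Nat.Properties
  using (≤-refl; ≤-trans; ≤-<-trans; ≤-pred; m≤m+n; m≤n+m; m≤n⇒m≤1+n; m<n⇒m<1+n;
         m≤n⇒m<n∨m≡n; n≤0⇒n≡0; n≤1+n; +-mono-≤; *-monoʳ-≤; *-monoˡ-≤; _≤?_; ≰⇒>)
import Data.Nat.Properties as ℕP
import Data.Nat.Divisibility as ℕD
import Data.Nat.Tactic.RingSolver as ℕ-Solver
open import Data.List using (List; []; _∷_; length)
open import Data.List.Membership.Propositional using (_∈_; _∉_)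
open import Data.List.Relation.Unary.Any using (here; there)
open import Data.Product using (∃; _,_; proj₁; proj₂)
open import Data.Sum using (_⊎_; inj₁; inj₂)
open import Data.Empty using (⊥-elim)
open import Function using (_∘_)
open import Relation.Nullary using (yes; no)
open import Relation.Binary.PropositionalEquality

module NatBounds where

  open import Data.Nat using (_+_; _*_; _⊔_; _≤′_; ≤′-reflexive; ≤′-step)
  open ℕP using (≤⇒≤′; ≤′⇒≤; module ≤-Reasoning; m^n>0; m^n≢0;
                *-monoʳ-<; *-monoˡ-<; +-monoʳ-<; +-monoˡ-<; +-identityʳ;
                m≤m⊔n; m≤n⊔m; *-distribʳ-⊔; ⊔-pres-<m)
  open ℕ-Solver using (solve-∀)

  average-< : ∀ u v P {B} → u * (2 * P) < B → v * (2 * P) < B → (u + v) * P < B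
  average-< u v P {B} u< v< = begin-strict
    (u + v) * P                ≤⟨ *-monoˡ-≤ P (+-mono-≤ (m≤m⊔n u v) (m≤n⊔m u v)) ⟩
    ((u ⊔ v) + (u ⊔ v)) * P    ≡⟨ double (u ⊔ v) P ⟩
    (u ⊔ v) * (2 * P)          ≡⟨ *-distribʳ-⊔ (2 * P) u v ⟩
    u * (2 * P) ⊔ v * (2 * P)  <⟨ ⊔-pres-<m u< v< ⟩
    B                          ∎
    where
    open ≤-Reasoning
    double : ∀ w P → (w + w) * P ≡ w * (2 * P)
    double = solve-∀

  bounded-on-list : ∀ {A : Set} (h : A → ℕ) (xs : List A) → ∃ λ B → ∀ {x} → x ∈ xs → h x ≤ B
  bounded-on-list h []       = 0 , λ ()
  bounded-on-list h (x ∷ xs) with bounded-on-list h xs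
  ... | B , h≤B = h x + B , λ { (here refl) → m≤m+n (h x) B
                              ; (there y∈xs) → ≤-trans (h≤B y∈xs) (m≤n+m B (h x)) }

  *2^<!-suc : ∀ A {m} → 1 ≤ m → A * 2 ^ m < m ! → A * 2 ^ suc m < suc m !
  *2^<!-suc A {m} 1≤m A*2^m<m! = begin-strict
    A * (2 * 2 ^ m)  ≡⟨ swap A (2 ^ m) ⟩
    2 * (A * 2 ^ m)  <⟨ *-monoʳ-< 2 A*2^m<m! ⟩
    2 * m !          ≤⟨ *-monoˡ-≤ (m !) (s≤s 1≤m) ⟩
    suc m * m !      ∎
    where
    open ≤-Reasoning
    swap : ∀ a b → a * (2 * b) ≡ 2 * (a * b)
    swap = solve-∀

  *2^<!-mono : ∀ A {m n} → 1 ≤ m → m ≤ n → A * 2 ^ m < m ! → A * 2 ^ n < n !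
  *2^<!-mono A {m} 1≤m m≤n = go (≤⇒≤′ m≤n)
    where
    go : ∀ {n} → m ≤′ n → A * 2 ^ m < m ! → A * 2 ^ n < n !
    go (≤′-reflexive refl) h = h
    go (≤′-step m≤′n)      h = *2^<!-suc A (≤-trans 1≤m (≤′⇒≤ m≤′n)) (go m≤′n h)

  n<2^n : ∀ n → n < 2 ^ n
  n<2^n zero    = z<s
  n<2^n (suc n) = begin-strict
    suc n               ≤⟨ n<2^n n ⟩
    2 ^ n               ≡⟨ +-identityʳ (2 ^ n) ⟨
    2 ^ n + 0           <⟨ +-monoʳ-< (2 ^ n) (+-monoˡ-< 0 (m^n>0 2 n)) ⟩
    2 ^ n + (2 ^ n + 0) ∎
    where open ≤-Reasoning

  24*[2^n]²≤[4+n]! : ∀ n → 24 * (2 ^ n * 2 ^ n) ≤ (4 + n) !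
  24*[2^n]²≤[4+n]! zero    = ≤-refl
  24*[2^n]²≤[4+n]! (suc n) = begin
    24 * ((2 * 2 ^ n) * (2 * 2 ^ n))  ≡⟨ regroup (2 ^ n) ⟩
    4 * (24 * (2 ^ n * 2 ^ n))        ≤⟨ *-monoʳ-≤ 4 (24*[2^n]²≤[4+n]! n) ⟩
    4 * (4 + n) !                     ≤⟨ *-monoˡ-≤ ((4 + n) !) (m≤m+n 4 (suc n)) ⟩
    (5 + n) * (4 + n) !               ∎
    where
    open ≤-Reasoning
    regroup : ∀ x → 24 * ((2 * x) * (2 * x)) ≡ 4 * (24 * (x * x))
    regroup = solve-∀

  *2^<!-base : ∀ A → A * 2 ^ (4 + A) < (4 + A) !
  *2^<!-base A = begin-strict
    A * 2 ^ (4 + A)       ≡⟨ regroup A (2 ^ A) ⟩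
    16 * (A * 2 ^ A)      <⟨ *-monoʳ-< 16 (*-monoˡ-< (2 ^ A) {{m^n≢0 2 A}} (n<2^n A)) ⟩
    16 * (2 ^ A * 2 ^ A)  ≤⟨ *-monoˡ-≤ (2 ^ A * 2 ^ A) (m≤n+m 16 8) ⟩
    24 * (2 ^ A * 2 ^ A)  ≤⟨ 24*[2^n]²≤[4+n]! A ⟩
    (4 + A) !             ∎
    where
    open ≤-Reasoning
    regroup : ∀ a x → a * (2 * (2 * (2 * (2 * x)))) ≡ 16 * (a * x)
    regroup = solve-∀

  *2^<!-from-4+ : ∀ A {n} → 4 + A ≤ n → A * 2 ^ n < n !
  *2^<!-from-4+ A 4+A≤n = *2^<!-mono A (s≤s z≤n) 4+A≤n (*2^<!-base A)

  *2^<!-from-2y∸1 : ∀ A {y n} → 1 ≤ y → 2 * y ≤ suc n →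
    A * 2 ^ (2 * y ∸ 1) < (2 * y ∸ 1) ! → A * 2 ^ n < n !
  *2^<!-from-2y∸1 A {suc y} (s≤s z≤n) 2y≤1+n = *2^<!-mono A 1≤2y-1 (ℕP.∸-monoˡ-≤ 1 2y≤1+n)
    where
    1≤2y-1 : 1 ≤ 2 * suc y ∸ 1
    1≤2y-1 = ≤-trans (s≤s z≤n) (m≤n+m (suc y + 0) y)

open NatBounds
open import Data.Integer using (ℤ; +_; -[1+_]; _+_; _*_; _-_; -_; ∣_∣)
open import Data.Integer.Tactic.RingSolver using (solve-∀)

shift-suc : ∀ a i → a + + i + + 1 ≡ a + + suc i
shift-suc a i = reassoc a (+ i)
  where
  reassoc : ∀ (a i : ℤ) → a + i + + 1 ≡ a + (+ 1 + i)
  reassoc = solve-∀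

Δ : (ℤ → ℤ) → ℤ → ℤ
Δ g x = g (x + + 1) - g x

Δ[_] : ℕ → (ℤ → ℤ) → ℤ → ℤ
Δ[ zero  ] g = g
Δ[ suc n ] g = Δ[ n ] (Δ g)

Δⁿ-cong : ∀ n {g h} → g ≗ h → Δ[ n ] g ≗ Δ[ n ] h
Δⁿ-cong zero    g≗h = g≗h
Δⁿ-cong (suc n) g≗h = Δⁿ-cong n λ x → cong₂ _-_ (g≗h (x + + 1)) (g≗h x)

Δⁿ-local : ∀ n {g h} a → (∀ i → i ≤ n → g (a + + i) ≡ h (a + + i)) → Δ[ n ] g a ≡ Δ[ n ] h a
Δⁿ-local zero    {g} {h} a g≡h = subst (λ x → g x ≡ h x) (ℤP.+-identityʳ a) (g≡h 0 z≤n)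
Δⁿ-local (suc n) {g} {h} a g≡h = Δⁿ-local n a λ i i≤n →
  cong₂ _-_ (at-suc i (s≤s i≤n)) (g≡h i (m≤n⇒m≤1+n i≤n))
  where
  at-suc : ∀ i → suc i ≤ suc n → g (a + + i + + 1) ≡ h (a + + i + + 1)
  at-suc i le rewrite shift-suc a i = g≡h (suc i) le

Δⁿ-shift : ∀ n g a → Δ[ n ] (λ x → g (x + + 1)) a ≡ Δ[ n ] g (a + + 1)
Δⁿ-shift zero    g a = refl
Δⁿ-shift (suc n) g a = Δⁿ-shift n (Δ g) a

Δⁿ-0 : ∀ n a → Δ[ n ] (λ _ → + 0) a ≡ + 0
Δⁿ-0 zero    a = refl
Δⁿ-0 (suc n) a = Δⁿ-0 n a

Δⁿ-add : ∀ n g h a → Δ[ n ] (λ x → g x + h x) a ≡ Δ[ n ] g a + Δ[ n ] h a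
Δⁿ-add zero    g h a = refl
Δⁿ-add (suc n) g h a = trans (Δⁿ-cong n (λ x → regroup (g (x + + 1)) (h (x + + 1)) (g x) (h x)) a)
                             (Δⁿ-add n (Δ g) (Δ h) a)
  where
  regroup : ∀ a b c d → (a + b) - (c + d) ≡ (a - c) + (b - d)
  regroup = solve-∀

Δⁿ-sub : ∀ n g h a → Δ[ n ] (λ x → g x - h x) a ≡ Δ[ n ] g a - Δ[ n ] h a
Δⁿ-sub zero    g h a = refl
Δⁿ-sub (suc n) g h a = trans (Δⁿ-cong n (λ x → regroup (g (x + + 1)) (h (x + + 1)) (g x) (h x)) a)
                             (Δⁿ-sub n (Δ g) (Δ h) a)
  where
  regroup : ∀ a b c d → (a - b) - (c - d) ≡ (a - c) - (b - d)
  regroup = solve-∀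

Δⁿ-const+ : ∀ n c g a → Δ[ suc n ] (λ x → c + g x) a ≡ Δ[ suc n ] g a
Δⁿ-const+ n c g = Δⁿ-cong n λ x → cancel c (g (x + + 1)) (g x)
  where
  cancel : ∀ c a b → (c + a) - (c + b) ≡ a - b
  cancel = solve-∀

Δⁿ-x* : ∀ n g a →
  Δ[ suc n ] (λ x → x * g x) a ≡ a * Δ[ suc n ] g a + + suc n * Δ[ n ] g (a + + 1)
Δⁿ-x* zero    g a = regroup a (g (a + + 1)) (g a)
  where
  regroup : ∀ a u v → (a + + 1) * u - a * v ≡ a * (u - v) + + 1 * u
  regroup = solve-∀
Δⁿ-x* (suc n) g a = begin
  Δ[ suc n ] (Δ (λ x → x * g x)) a
    ≡⟨ Δⁿ-cong (suc n) (λ x → product-rule x (g (x + + 1)) (g x)) a ⟩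
  Δ[ suc n ] (λ x → g (x + + 1) + x * Δ g x) a
    ≡⟨ Δⁿ-add (suc n) (λ x → g (x + + 1)) (λ x → x * Δ g x) a ⟩
  Δ[ suc n ] (λ x → g (x + + 1)) a + Δ[ suc n ] (λ x → x * Δ g x) a
    ≡⟨ cong₂ _+_ (Δⁿ-shift (suc n) g a) (Δⁿ-x* n (Δ g) a) ⟩
  Δ[ suc n ] g (a + + 1) + (a * Δ[ suc (suc n) ] g a + + suc n * Δ[ suc n ] g (a + + 1))
    ≡⟨ regroup a (Δ[ suc n ] g (a + + 1)) (Δ[ suc (suc n) ] g a) (+ suc n) ⟩
  a * Δ[ suc (suc n) ] g a + + suc (suc n) * Δ[ suc n ] g (a + + 1) ∎
  where
  open ≡-Reasoning
  product-rule : ∀ x u v → (x + + 1) * u - x * v ≡ u + x * (u - v)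
  product-rule = solve-∀
  regroup : ∀ a X Y N → X + (a * Y + N * X) ≡ a * Y + (+ 1 + N) * X
  regroup = solve-∀

Δⁿ-eval-∷ : ∀ n c r a →
  Δ[ suc n ] (eval (c ∷ r)) a ≡ a * Δ[ suc n ] (eval r) a + + suc n * Δ[ n ] (eval r) (a + + 1)
Δⁿ-eval-∷ n c r a = trans (Δⁿ-const+ n c (λ x → x * eval r x) a) (Δⁿ-x* n (eval r) a)

Δⁿ-eval≡0 : ∀ p {n} → length p ≤ n → ∀ a → Δ[ n ] (eval p) a ≡ + 0
Δⁿ-eval≡0 []      {n}     _            a = Δⁿ-0 n a
Δⁿ-eval≡0 (c ∷ r) {suc n} (s≤s len≤n) a = begin
  Δ[ suc n ] (eval (c ∷ r)) a
    ≡⟨ Δⁿ-eval-∷ n c r a ⟩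
  a * Δ[ suc n ] (eval r) a + + suc n * Δ[ n ] (eval r) (a + + 1)
    ≡⟨ cong₂ (λ u v → a * u + + suc n * v)
             (Δⁿ-eval≡0 r (m≤n⇒m≤1+n len≤n) a) (Δⁿ-eval≡0 r len≤n (a + + 1)) ⟩
  a * + 0 + + suc n * + 0
    ≡⟨ vanish a (+ suc n) ⟩
  + 0 ∎
  where
  open ≡-Reasoning
  vanish : ∀ a N → a * + 0 + N * + 0 ≡ + 0
  vanish = solve-∀

n!∣Δⁿ-eval : ∀ p n a → + (n !) ∣ Δ[ n ] (eval p) a
n!∣Δⁿ-eval p       zero    a = ∣ᵤ⇒∣ (ℕD.1∣ _)
n!∣Δⁿ-eval []      (suc n) a = subst (_ ∣_) (sym (Δⁿ-0 (suc n) a)) (∣ᵤ⇒∣ (_ ℕD.∣0))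
n!∣Δⁿ-eval (c ∷ r) (suc n) a = subst (_ ∣_) (sym (Δⁿ-eval-∷ n c r a))
  (∣m∣n⇒∣m+n (∣n⇒∣m*n a (n!∣Δⁿ-eval r (suc n) a))
             (subst (_∣ + suc n * Δ[ n ] (eval r) (a + + 1)) (sym (ℤP.pos-* (suc n) (n !)))
                    (*-monoʳ-∣ (+ suc n) (n!∣Δⁿ-eval r n (a + + 1)))))

∣Δⁿ∣< : ∀ n {g} a {B} → (∀ i → i ≤ n → ∣ g (a + + i) ∣ ℕ.* 2 ^ n < B) → ∣ Δ[ n ] g a ∣ < B
∣Δⁿ∣< zero    {g} a {B} bound =
  subst (λ x → ∣ g x ∣ < B) (ℤP.+-identityʳ a) (subst (_< B) (ℕP.*-identityʳ _) (bound 0 z≤n))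
∣Δⁿ∣< (suc n) {g} a {B} bound = ∣Δⁿ∣< n a λ i i≤n → begin-strict
  ∣ Δ g (a + + i) ∣ ℕ.* 2 ^ n
    ≤⟨ *-monoˡ-≤ (2 ^ n) (ℤP.∣i-j∣≤∣i∣+∣j∣ (g (a + + i + + 1)) (g (a + + i))) ⟩
  (∣ g (a + + i + + 1) ∣ ℕ.+ ∣ g (a + + i) ∣) ℕ.* 2 ^ n
    <⟨ average-< ∣ g (a + + i + + 1) ∣ ∣ g (a + + i) ∣ (2 ^ n)
                 (next i (s≤s i≤n)) (bound i (m≤n⇒m≤1+n i≤n)) ⟩
  B ∎
  where
  open ℕP.≤-Reasoning
  next : ∀ i → suc i ≤ suc n → ∣ g (a + + i + + 1) ∣ ℕ.* 2 ^ suc n < B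
  next i le rewrite shift-suc a i = bound (suc i) le

Δ≡0 : ∀ {g} a i → g (a + + suc i) ≡ + 0 → g (a + + i) ≡ + 0 → Δ g (a + + i) ≡ + 0
Δ≡0 {g} a i g[a+i+1]≡0 g[a+i]≡0 =
  cong₂ _-_ (trans (cong g (shift-suc a i)) g[a+i+1]≡0) g[a+i]≡0

Δⁿ-last : ∀ n {g} a → (∀ i → i < n → g (a + + i) ≡ + 0) → Δ[ n ] g a ≡ g (a + + n)
Δⁿ-last zero    {g} a _   = cong g (sym (ℤP.+-identityʳ a))
Δⁿ-last (suc n) {g} a g≡0 = begin
  Δ[ n ] (Δ g) a
    ≡⟨ Δⁿ-last n a (λ i i<n → Δ≡0 {g} a i (g≡0 (suc i) (s≤s i<n)) (g≡0 i (m<n⇒m<1+n i<n))) ⟩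
  g (a + + n + + 1) - g (a + + n)
    ≡⟨ cong₂ _-_ (cong g (shift-suc a n)) (g≡0 n ≤-refl) ⟩
  g (a + + suc n) - + 0
    ≡⟨ ℤP.+-identityʳ _ ⟩
  g (a + + suc n) ∎
  where open ≡-Reasoning

∣Δⁿ∣-first : ∀ n {g} a → (∀ i → i < n → g (a + + suc i) ≡ + 0) → ∣ Δ[ n ] g a ∣ ≡ ∣ g a ∣
∣Δⁿ∣-first zero    a _   = refl
∣Δⁿ∣-first (suc n) {g} a g≡0 = begin
  ∣ Δ[ n ] (Δ g) a ∣
    ≡⟨ ∣Δⁿ∣-first n a (λ i i<n →
         Δ≡0 {g} a (suc i) (g≡0 (suc i) (s≤s i<n)) (g≡0 i (m<n⇒m<1+n i<n))) ⟩
  ∣ g (a + + 1) - g a ∣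
    ≡⟨ cong (λ y → ∣ y - g a ∣) (g≡0 0 z<s) ⟩
  ∣ + 0 - g a ∣
    ≡⟨ cong ∣_∣ (ℤP.+-identityˡ (- g a)) ⟩
  ∣ - g a ∣
    ≡⟨ ℤP.∣-i∣≡∣i∣ (g a) ⟩
  ∣ g a ∣ ∎
  where open ≡-Reasoning

addConst : ℤ → Poly → Poly
addConst b []       = b ∷ []
addConst b (c ∷ cs) = b + c ∷ cs

eval-addConst : ∀ b p x → eval (addConst b p) x ≡ b + eval p x
eval-addConst b []       x = cong (λ y → b + y) (ℤP.*-zeroʳ x)
eval-addConst b (c ∷ cs) x = ℤP.+-assoc b c (x * eval cs x)

length-addConst : ∀ b p {m} → length p ≤ suc m → length (addConst b p) ≤ suc m
length-addConst b []       _   = s≤s z≤n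
length-addConst b (c ∷ cs) len = len

mulLinear : ℤ → Poly → Poly
mulLinear w []       = []
mulLinear w (b ∷ bs) = - (w * b) ∷ addConst b (mulLinear w bs)

eval-mulLinear : ∀ w p x → eval (mulLinear w p) x ≡ (x - w) * eval p x
eval-mulLinear w []       x = sym (ℤP.*-zeroʳ (x - w))
eval-mulLinear w (b ∷ bs) x = begin
  - (w * b) + x * eval (addConst b (mulLinear w bs)) x
    ≡⟨ cong (λ y → - (w * b) + x * y) (eval-addConst b (mulLinear w bs) x) ⟩
  - (w * b) + x * (b + eval (mulLinear w bs) x)
    ≡⟨ cong (λ y → - (w * b) + x * (b + y)) (eval-mulLinear w bs x) ⟩
  - (w * b) + x * (b + (x - w) * eval bs x)
    ≡⟨ regroup x w b (eval bs x) ⟩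
  (x - w) * (b + x * eval bs x) ∎
  where
  open ≡-Reasoning
  regroup : ∀ x w b B → - (w * b) + x * (b + (x - w) * B) ≡ (x - w) * (b + x * B)
  regroup = solve-∀

length-mulLinear : ∀ w p → length (mulLinear w p) ≤ suc (length p)
length-mulLinear w []       = z≤n
length-mulLinear w (b ∷ bs) = s≤s (length-addConst b (mulLinear w bs) (length-mulLinear w bs))

quotient : Poly → ℤ → Poly
quotient []      w = []
quotient (a ∷ r) w = eval r w ∷ quotient r w

eval-quotient : ∀ p w x → eval p x ≡ eval p w + (x - w) * eval (quotient p w) x
eval-quotient []      w x = sym (trans (ℤP.+-identityˡ _) (ℤP.*-zeroʳ (x - w)))
eval-quotient (a ∷ r) w x = begin
  a + x * eval r x
    ≡⟨ cong (λ y → a + x * y) (eval-quotient r w x) ⟩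
  a + x * (eval r w + (x - w) * eval (quotient r w) x)
    ≡⟨ regroup x w a (eval r w) (eval (quotient r w) x) ⟩
  (a + w * eval r w) + (x - w) * (eval r w + x * eval (quotient r w) x) ∎
  where
  open ≡-Reasoning
  regroup : ∀ x w a R Q → a + x * (R + (x - w) * Q) ≡ (a + w * R) + (x - w) * (R + x * Q)
  regroup = solve-∀

-- p modulo ∏_{w ∈ ws} (x - w)
remainder : List ℤ → Poly → Poly
remainder []       p = []
remainder (w ∷ ws) p = addConst (eval p w) (mulLinear w (remainder ws (quotient p w)))

length-remainder : ∀ ws p → length (remainder ws p) ≤ length ws
length-remainder []       p = z≤n
length-remainder (w ∷ ws) p = length-addConst (eval p w) (mulLinear w r)
  (≤-trans (length-mulLinear w r) (s≤s (length-remainder ws (quotient p w))))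
  where r = remainder ws (quotient p w)

eval-remainder : ∀ ws p {x} → x ∈ ws → eval p x ≡ eval (remainder ws p) x
eval-remainder (w ∷ ws) p {x} x∈w∷ws = begin
  eval p x
    ≡⟨ at x∈w∷ws ⟩
  eval p w + (x - w) * eval r x
    ≡⟨ cong (λ y → eval p w + y) (eval-mulLinear w r x) ⟨
  eval p w + eval (mulLinear w r) x
    ≡⟨ eval-addConst (eval p w) (mulLinear w r) x ⟨
  eval (remainder (w ∷ ws) p) x ∎
  where
  open ≡-Reasoning
  r = remainder ws (quotient p w)
  at : x ∈ w ∷ ws → eval p x ≡ eval p w + (x - w) * eval r x
  at (here refl) = sym (begin
    eval p x + (x - x) * eval r x
      ≡⟨ cong (λ y → eval p x + y * eval r x) (ℤP.+-inverseʳ x) ⟩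
    eval p x + + 0 * eval r x
      ≡⟨ ℤP.+-identityʳ (eval p x) ⟩
    eval p x ∎)
  at (there x∈ws) = begin
    eval p x
      ≡⟨ eval-quotient p w x ⟩
    eval p w + (x - w) * eval (quotient p w) x
      ≡⟨ cong (λ y → eval p w + (x - w) * y) (eval-remainder ws (quotient p w) x∈ws) ⟩
    eval p w + (x - w) * eval r x ∎

segment : ℤ → ℕ → List ℤ
segment a zero    = a ∷ []
segment a (suc n) = a ∷ segment (a + + 1) n

∈-segment : ∀ a {n i} → i ≤ n → a + + i ∈ segment a n
∈-segment a {zero}  {zero}  _         = here (ℤP.+-identityʳ a)
∈-segment a {suc n} {zero}  _         = here (ℤP.+-identityʳ a)
∈-segment a {suc n} {suc i} (s≤s i≤n) =
  there (subst (_∈ segment (a + + 1) n) (regroup a (+ i)) (∈-segment (a + + 1) i≤n))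
  where
  regroup : ∀ a i → a + + 1 + i ≡ a + (+ 1 + i)
  regroup = solve-∀

ball : ℕ → List ℤ
ball zero    = + 0 ∷ []
ball (suc k) = + suc k ∷ -[1+ k ] ∷ ball k

length-ball : ∀ k → length (ball k) ≡ suc (k ℕ.+ k)
length-ball zero    = refl
length-ball (suc k) = cong (suc ∘ suc) (trans (length-ball k) (sym (ℕP.+-suc k k)))

∣x∣≤1+k⇒ : ∀ {k} x → ∣ x ∣ ≤ suc k → ∣ x ∣ ≤ k ⊎ x ≡ + suc k ⊎ x ≡ -[1+ k ]
∣x∣≤1+k⇒ (+ n) n≤1+k with m≤n⇒m<n∨m≡n n≤1+k
... | inj₁ n<1+k = inj₁ (≤-pred n<1+k)
... | inj₂ refl  = inj₂ (inj₁ refl)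
∣x∣≤1+k⇒ -[1+ n ] 1+n≤1+k with m≤n⇒m<n∨m≡n 1+n≤1+k
... | inj₁ 1+n<1+k = inj₁ (≤-pred 1+n<1+k)
... | inj₂ refl    = inj₂ (inj₂ refl)

∈-ball : ∀ k {x} → ∣ x ∣ ≤ k → x ∈ ball k
∈-ball zero    ∣x∣≤0 = here (ℤP.∣i∣≡0⇒i≡0 (n≤0⇒n≡0 ∣x∣≤0))
∈-ball (suc k) {x} ∣x∣≤1+k with ∣x∣≤1+k⇒ x ∣x∣≤1+k
... | inj₁ ∣x∣≤k        = there (there (∈-ball k ∣x∣≤k))
... | inj₂ (inj₁ refl) = here refl
... | inj₂ (inj₂ refl) = there (here refl)

∣-m+i∣≤m : ∀ m i → i ≤ m ℕ.+ m → ∣ - + m + + i ∣ ≤ m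
∣-m+i∣≤m m i i≤2m rewrite ℤP.-m+n≡n⊖m m i with i ≤? m
... | yes i≤m = subst (_≤ m) (sym (ℤP.∣⊖∣-≤ i≤m)) (ℕP.m∸n≤m m i)
... | no  i≰m = subst (_≤ m) (sym (trans (ℤP.∣m⊖n∣≡∣n⊖m∣ i m) (ℤP.∣⊖∣-< (≰⇒> i≰m))))
                      (subst (i ∸ m ≤_) (ℕP.m+n∸m≡n m m) (ℕP.∸-monoˡ-≤ m i≤2m))

ZeroOnBall : (ℤ → ℤ) → ℕ → Set
ZeroOnBall g k = ∀ x → ∣ x ∣ ≤ k → g x ≡ + 0

CentralDifferencesVanish : ℕ → (ℤ → ℤ) → Set
CentralDifferencesVanish N g =
  ∀ n m a → N ≤ n → 2 ℕ.* m ≤ suc n → (∀ i → i ≤ n → ∣ a + + i ∣ ≤ m) → Δ[ n ] g a ≡ + 0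

CentralDifferencesVanish-mono : ∀ {N N′ g} → N ≤ N′ →
  CentralDifferencesVanish N g → CentralDifferencesVanish N′ g
CentralDifferencesVanish-mono N≤N′ Δg≡0 n m a N′≤n = Δg≡0 n m a (≤-trans N≤N′ N′≤n)

2[1+k]≡2+2k : ∀ k → 2 ℕ.* suc k ≡ suc (suc (k ℕ.+ k))
2[1+k]≡2+2k = ℕ-Solver.solve-∀

-[1+k]+1+i≡-k+i : ∀ k i → -[1+ k ] + + suc i ≡ - + k + + i
-[1+k]+1+i≡-k+i k i = regroup (+ k) (+ i)
  where
  regroup : ∀ k i → - (+ 1 + k) + (+ 1 + i) ≡ - k + i
  regroup = solve-∀

-k+[1+2k]≡1+k : ∀ k → - + k + + suc (k ℕ.+ k) ≡ + suc k
-k+[1+2k]≡1+k k = cancel (+ k) (+ suc k)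
  where
  cancel : ∀ k s → - k + (s + k) ≡ s
  cancel = solve-∀

∣-[1+k]+i∣≤1+k : ∀ k i → i ≤ suc (suc (k ℕ.+ k)) → ∣ -[1+ k ] + + i ∣ ≤ suc k
∣-[1+k]+i∣≤1+k k i i≤2+2k =
  ∣-m+i∣≤m (suc k) i (subst (i ≤_) (cong suc (sym (ℕP.+-suc k k))) i≤2+2k)

∣-k+i∣≤1+k : ∀ k i → i ≤ suc (k ℕ.+ k) → ∣ - + k + + i ∣ ≤ suc k
∣-k+i∣≤1+k k i i≤1+2k =
  subst (λ x → ∣ x ∣ ≤ suc k) (-[1+k]+1+i≡-k+i k i) (∣-[1+k]+i∣≤1+k k (suc i) (s≤s i≤1+2k))

zero-at-1+k : ∀ {g k} → CentralDifferencesVanish (suc (k ℕ.+ k)) g → ZeroOnBall g k →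
  g (+ suc k) ≡ + 0
zero-at-1+k {g} {k} Δg≡0 g≡0 = begin
  g (+ suc k)
    ≡⟨ cong g (-k+[1+2k]≡1+k k) ⟨
  g (- + k + + suc (k ℕ.+ k))
    ≡⟨ Δⁿ-last (suc (k ℕ.+ k)) {g} (- + k) (λ i i<1+2k → g≡0 _ (∣-m+i∣≤m k i (≤-pred i<1+2k))) ⟨
  Δ[ suc (k ℕ.+ k) ] g (- + k)
    ≡⟨ Δg≡0 _ (suc k) (- + k) ≤-refl (ℕP.≤-reflexive (2[1+k]≡2+2k k)) (∣-k+i∣≤1+k k) ⟩
  + 0 ∎
  where open ≡-Reasoning

zero-at--[1+k] : ∀ {g k} → CentralDifferencesVanish (suc (k ℕ.+ k)) g → ZeroOnBall g k →
  g -[1+ k ] ≡ + 0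
zero-at--[1+k] {g} {k} Δg≡0 g≡0 = ℤP.∣i∣≡0⇒i≡0 (begin
  ∣ g -[1+ k ] ∣
    ≡⟨ ∣Δⁿ∣-first (suc (suc (k ℕ.+ k))) {g} -[1+ k ] (λ i i<2+2k →
         subst (λ x → g x ≡ + 0) (sym (-[1+k]+1+i≡-k+i k i)) (zero-from--k i (≤-pred i<2+2k))) ⟨
  ∣ Δ[ suc (suc (k ℕ.+ k)) ] g -[1+ k ] ∣
    ≡⟨ cong ∣_∣ (Δg≡0 _ (suc k) -[1+ k ] (n≤1+n _)
                       (≤-trans (ℕP.≤-reflexive (2[1+k]≡2+2k k)) (n≤1+n _)) (∣-[1+k]+i∣≤1+k k)) ⟩
  0 ∎)
  where
  open ≡-Reasoning
  zero-from--k : ∀ i → i ≤ suc (k ℕ.+ k) → g (- + k + + i) ≡ + 0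
  zero-from--k i i≤1+2k with m≤n⇒m<n∨m≡n i≤1+2k
  ... | inj₁ i<1+2k = g≡0 _ (∣-m+i∣≤m k i (≤-pred i<1+2k))
  ... | inj₂ refl   = trans (cong g (-k+[1+2k]≡1+k k)) (zero-at-1+k Δg≡0 g≡0)

ZeroOnBall-suc : ∀ {g k} → CentralDifferencesVanish (suc (k ℕ.+ k)) g → ZeroOnBall g k →
  ZeroOnBall g (suc k)
ZeroOnBall-suc Δg≡0 g≡0 x ∣x∣≤1+k with ∣x∣≤1+k⇒ x ∣x∣≤1+k
... | inj₁ ∣x∣≤k        = g≡0 x ∣x∣≤k
... | inj₂ (inj₁ refl) = zero-at-1+k Δg≡0 g≡0
... | inj₂ (inj₂ refl) = zero-at--[1+k] Δg≡0 g≡0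

zero-everywhere : ∀ {g k} → CentralDifferencesVanish (suc (k ℕ.+ k)) g → ZeroOnBall g k →
  ∀ x → g x ≡ + 0
zero-everywhere {g} {k} Δg≡0 g≡0 x = zero-on (∣ x ∣) x (m≤m+n ∣ x ∣ k)
  where
  zero-on : ∀ d → ZeroOnBall g (d ℕ.+ k)
  zero-on zero    = g≡0
  zero-on (suc d) = ZeroOnBall-suc (CentralDifferencesVanish-mono larger Δg≡0) (zero-on d)
    where
    larger : suc (k ℕ.+ k) ≤ suc ((d ℕ.+ k) ℕ.+ (d ℕ.+ k))
    larger = s≤s (+-mono-≤ (m≤n+m k d) (m≤n+m k d))

polynomial-of-vanishing-differences : ∀ {f N} → LIP f → CentralDifferencesVanish N f →
  ∃ λ (p : Poly) → ∀ x → f x ≡ eval p x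
polynomial-of-vanishing-differences {f} {N} lip Δf≡0 =
  q , λ x → ℤP.i-j≡0⇒i≡j (f x) (eval q x) (zero-everywhere Δg≡0 g≡0 x)
  where
  p : Poly
  p = proj₁ (lip (ball N))
  q : Poly
  q = remainder (ball N) p
  g : ℤ → ℤ
  g x = f x - eval q x
  g≡0 : ZeroOnBall g N
  g≡0 x ∣x∣≤N =
    ℤP.i≡j⇒i-j≡0 (trans (proj₂ (lip (ball N)) x x∈ball) (eval-remainder (ball N) p x∈ball))
    where x∈ball = ∈-ball N ∣x∣≤N
  Δg≡0 : CentralDifferencesVanish (suc (N ℕ.+ N)) g
  Δg≡0 n m a 1+2N≤n 2m≤1+n window = begin
    Δ[ n ] g a                      ≡⟨ Δⁿ-sub n f (eval q) a ⟩
    Δ[ n ] f a - Δ[ n ] (eval q) a  ≡⟨ cong₂ _-_ (Δf≡0 n m a N≤n 2m≤1+n window)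
                                                 (Δⁿ-eval≡0 q length-q≤n a) ⟩
    + 0 - + 0                       ≡⟨⟩
    + 0                             ∎
    where
    open ≡-Reasoning
    N≤n : N ≤ n
    N≤n = ≤-trans (m≤n+m N (suc N)) 1+2N≤n
    length-q≤n : length q ≤ n
    length-q≤n = ≤-trans (length-remainder (ball N) p) (subst (_≤ n) (sym (length-ball N)) 1+2N≤n)

n∣i∧∣i∣<n⇒i≡0 : ∀ {n i} → + n ∣ i → ∣ i ∣ < n → i ≡ + 0
n∣i∧∣i∣<n⇒i≡0 {i = + zero}   _   _      = refl
n∣i∧∣i∣<n⇒i≡0 {i = + suc _}  n∣i ∣i∣<n = ⊥-elim (ℕD.>⇒∤ ∣i∣<n (∣⇒∣ᵤ n∣i))
n∣i∧∣i∣<n⇒i≡0 {i = -[1+ _ ]} n∣i ∣i∣<n = ⊥-elim (ℕD.>⇒∤ ∣i∣<n (∣⇒∣ᵤ n∣i))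

central-differences-vanish : ∀ {f N} → LIP f →
  (∀ n x → N ≤ n → 2 ℕ.* ∣ x ∣ ≤ suc n → ∣ f x ∣ ℕ.* 2 ^ n < n !) →
  CentralDifferencesVanish N f
central-differences-vanish {f} lip small n m a N≤n 2m≤1+n window =
  n∣i∧∣i∣<n⇒i≡0 n!∣Δⁿf ∣Δⁿf∣<n!
  where
  p : Poly
  p = proj₁ (lip (segment a n))
  Δⁿf≡Δⁿp : Δ[ n ] f a ≡ Δ[ n ] (eval p) a
  Δⁿf≡Δⁿp = Δⁿ-local n a λ i i≤n → proj₂ (lip (segment a n)) _ (∈-segment a i≤n)
  n!∣Δⁿf : + (n !) ∣ Δ[ n ] f a
  n!∣Δⁿf = subst (+ (n !) ∣_) (sym Δⁿf≡Δⁿp) (n!∣Δⁿ-eval p n a)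
  ∣Δⁿf∣<n! : ∣ Δ[ n ] f a ∣ < n !
  ∣Δⁿf∣<n! = ∣Δⁿ∣< n a λ i i≤n →
    small n (a + + i) N≤n (≤-trans (*-monoʳ-≤ 2 (window i i≤n)) 2m≤1+n)

growth-eventually-below-factorial : ∀ {f} →
  (∃ λ (E : List ℤ) → ∀ x → x ≢ + 0 → x ∉ E → GrowthBound f x) →
  ∃ λ N → ∀ n x → N ≤ n → 2 ℕ.* ∣ x ∣ ≤ suc n → ∣ f x ∣ ℕ.* 2 ^ n < n !
growth-eventually-below-factorial {f} (E , growth)
  with bounded-on-list ∣_∣ E
... | R , ∣e∣≤R
  with bounded-on-list (∣_∣ ∘ f) (ball R)
... | M , ∣f∣≤M = 4 ℕ.+ M , small
  where
  small : ∀ n x → 4 ℕ.+ M ≤ n → 2 ℕ.* ∣ x ∣ ≤ suc n → ∣ f x ∣ ℕ.* 2 ^ n < n !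
  small n x 4+M≤n 2∣x∣≤1+n with ∣ x ∣ ≤? R
  ... | yes ∣x∣≤R = ≤-<-trans (*-monoˡ-≤ (2 ^ n) (∣f∣≤M (∈-ball R ∣x∣≤R))) (*2^<!-from-4+ M 4+M≤n)
  ... | no  ∣x∣≰R = *2^<!-from-2y∸1 ∣ f x ∣ {∣ x ∣} {n} 1≤∣x∣ 2∣x∣≤1+n (growth x x≢0 x∉E)
    where
    1≤∣x∣ : 1 ≤ ∣ x ∣
    1≤∣x∣ = ≤-trans (s≤s z≤n) (≰⇒> ∣x∣≰R)
    x≢0 : x ≢ + 0
    x≢0 refl = ∣x∣≰R z≤n
    x∉E : x ∉ E
    x∉E x∈E = ∣x∣≰R (∣e∣≤R x∈E)

theorem7 : (f : ℤ → ℤ) → LIP f →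
    (∃ λ (E : List ℤ) → ∀ x → x ≢ + 0 → x ∉ E → GrowthBound f x) →
    ∃ λ (p : Poly) → ∀ x → f x ≡ eval p x
theorem7 f lip growth =
  let N , small = growth-eventually-below-factorial {f} growth
  in polynomial-of-vanishing-differences lip (central-differences-vanish {N = N} lip small)
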